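{- Let $C \subseteq [q]^n$ be an $(n,d)_q$-code, let $j \in [n]$ and $\alpha \in [q]$, and let $B = \{w \in C : w_j = \alpha\}$. Suppose that for every column $i \in [n]\setminus\{j\}$, every symbol of $[q]$ occurs exactly $m$ times among the entries $w_i$, $w \in B$. If $n-d$ does not divide $m(n-1)$, then for each $u \in C \setminus B$ there is a word $v \in B$ with $d_H(u,v) \notin \{d, n\}$.
   Context: For $m \in \mathbb{N}$, $[m] = \{1,\ldots,m\}$. For words $u,v \in [q]^n$, $d_H(u,v)$ is the Hamming distance. An $(n,d)_q$-code is a set $C \subseteq [q]^n$ in which any two distinct words have Hamming distance at least $d$. The set $B$ of all words of $C$ having a fixed symbol in column $j$ is called a block for column $j$. -}

module Defs where

open import Data.Nat using (ℕ; zero; suc; _+_; _≥_)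
open import Data.Fin using (Fin; _≟_)
open import Data.Vec using (Vec; []; _∷_; lookup)
open import Data.List using (List; filter; length)
open import Data.List.Membership.Propositional using (_∈_)
open import Data.List.Relation.Unary.Unique.Propositional using (Unique)
open import Relation.Nullary using (yes; no; ¬_)
open import Relation.Binary.PropositionalEquality using (_≡_)
open import Data.Product using (_×_)

Word : ℕ → ℕ → Set
Word q n = Vec (Fin q) n

dH : ∀ {q n} → Word q n → Word q n → ℕ
dH [] [] = 0
dH (x ∷ xs) (y ∷ ys) with x ≟ y
... | yes _ = dH xs ys
... | no _ = suc (dH xs ys)

record IsCode (q n d : ℕ) (C : List (Word q n)) : Set where
  field
    distinct : Unique C
    minDist : ∀ {u v} → u ∈ C → v ∈ C → ¬ (u ≡ v) → dH u v ≥ d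

block : ∀ {q n} → List (Word q n) → Fin n → Fin q → List (Word q n)
block C j α = filter (λ w → lookup w j ≟ α) C

occurrences : ∀ {q n} → List (Word q n) → Fin n → Fin q → ℕ
occurrences B i s = length (filter (λ w → lookup w i ≟ s) B)

-- Double counting the agreements between u and the words of B column by
-- column: column j contributes nothing (all of B has α there, u does not) and
-- every other column contributes exactly m, so the agreements total m(n − 1).
-- If every v ∈ B were at distance d or n from u, each single agreement count
-- n − d_H(u,v) would be n − d or 0, and n − d would divide m(n − 1).
module Submission where

open import Defs
import Algebra.Properties.CommutativeMonoid.Sum as FinSum
open import Data.Nat using (ℕ; zero; suc; _+_; _*_; _∸_)
import Data.Nat as ℕ
open import Data.Nat.Divisibility using (_∣_; _∣0; ∣-refl; ∣m∣n⇒∣m+n)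
open import Data.Nat.ListAction using (sum)
open import Data.Nat.Properties using (+-0-commutativeMonoid; +-suc; m+n∸m≡n; n∸n≡0; *-comm)
open import Data.Fin using (Fin; _≟_; punchIn)
open import Data.Fin.Properties using (punchInᵢ≢i)
open import Data.Vec using (lookup; []; _∷_)
open import Data.List using (List; []; _∷_; map; filter; length)
open import Data.List.Properties using (filter-none)
open import Data.List.Membership.Propositional using (_∈_; find)
open import Data.List.Relation.Unary.All as All using (All; []; _∷_; all?)
open import Data.List.Relation.Unary.All.Properties using (all-filter; ¬All⇒Any¬)
open import Data.Product using (Σ; _×_; _,_)
open import Data.Sum using (_⊎_; inj₁; inj₂)
open import Function using (_∘_)
open import Relation.Nullary using (¬_; Dec; yes; no; contradiction)
open import Relation.Nullary.Decidable using (_⊎-dec_)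
open import Relation.Binary.PropositionalEquality using (_≡_; refl; sym; trans; cong; cong₂; subst; module ≡-Reasoning)

private
  module ∑ = FinSum +-0-commutativeMonoid

open ∑ using (sum-syntax)

indicator : ∀ {P : Set} → Dec P → ℕ
indicator (yes _) = 1
indicator (no _)  = 0

length-filter≡sum-indicator : ∀ {A : Set} {P : A → Set} (P? : ∀ x → Dec (P x)) (xs : List A) →
  length (filter P? xs) ≡ sum (map (indicator ∘ P?) xs)
length-filter≡sum-indicator P? [] = refl
length-filter≡sum-indicator P? (x ∷ xs) with P? x
... | yes _ = cong suc (length-filter≡sum-indicator P? xs)
... | no _  = length-filter≡sum-indicator P? xs

∣-sum-map : ∀ {A : Set} {k : ℕ} (f : A → ℕ) {xs : List A} →
  All (λ x → k ∣ f x) xs → k ∣ sum (map f xs)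
∣-sum-map f []           = _ ∣0
∣-sum-map f (k∣fx ∷ k∣f) = ∣m∣n⇒∣m+n k∣fx (∣-sum-map f k∣f)

sum-map-∑-comm : ∀ {A : Set} n (f : A → Fin n → ℕ) (xs : List A) →
  sum (map (λ x → ∑[ i < n ] f x i) xs) ≡ ∑[ i < n ] sum (map (λ x → f x i) xs)
sum-map-∑-comm n f []       = sym (∑.sum-replicate-zero n)
sum-map-∑-comm n f (x ∷ xs) =
  trans (cong (∑[ i < n ] f x i +_) (sum-map-∑-comm n f xs))
        (sym (∑.∑-distrib-+ (f x) (λ i → sum (map (λ y → f y i) xs))))

∑-const : ∀ n m → ∑[ i < n ] m ≡ n * m
∑-const zero    m = refl
∑-const (suc n) m = cong (m +_) (∑-const n m)

∑-zero-at-one-point : ∀ {n m} (g : Fin n → ℕ) (j : Fin n) →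
  g j ≡ 0 → (∀ i → ¬ i ≡ j → g i ≡ m) → ∑[ i < n ] g i ≡ m * (n ∸ 1)
∑-zero-at-one-point {suc n} {m} g j gj≡0 g≡m = begin
  ∑[ i < suc n ] g i               ≡⟨ ∑.sum-remove g ⟩
  g j + ∑[ k < n ] g (punchIn j k) ≡⟨ cong₂ _+_ gj≡0 (∑.sum-cong-≗ (λ k → g≡m _ (punchInᵢ≢i j k))) ⟩
  ∑[ k < n ] m                     ≡⟨ ∑-const n m ⟩
  n * m                            ≡⟨ *-comm n m ⟩
  m * n                            ∎
  where open ≡-Reasoning

agreements : ∀ {q n} → Word q n → Word q n → ℕ
agreements {n = n} u v = ∑[ i < n ] indicator (lookup v i ≟ lookup u i)

dH+agreements≡n : ∀ {q n} (u v : Word q n) → dH u v + agreements u v ≡ n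
dH+agreements≡n [] [] = refl
dH+agreements≡n (x ∷ xs) (y ∷ ys) with x ≟ y | y ≟ x
... | yes _   | yes _   = trans (+-suc _ _) (cong suc (dH+agreements≡n xs ys))
... | no _    | no _    = cong suc (dH+agreements≡n xs ys)
... | yes x≡y | no y≢x  = contradiction (sym x≡y) y≢x
... | no x≢y  | yes y≡x = contradiction (sym y≡x) x≢y

agreements≡n∸dH : ∀ {q n} (u v : Word q n) → agreements u v ≡ n ∸ dH u v
agreements≡n∸dH u v = trans (sym (m+n∸m≡n (dH u v) _)) (cong (_∸ dH u v) (dH+agreements≡n u v))

n∸d∣agreements : ∀ {q n d} (u v : Word q n) → dH u v ≡ d ⊎ dH u v ≡ n → (n ∸ d) ∣ agreements u v
n∸d∣agreements {n = n} {d} u v (inj₁ dH≡d) =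
  subst ((n ∸ d) ∣_) (sym (trans (agreements≡n∸dH u v) (cong (n ∸_) dH≡d))) ∣-refl
n∸d∣agreements {n = n} {d} u v (inj₂ dH≡n) =
  subst ((n ∸ d) ∣_) (sym (trans (agreements≡n∸dH u v) (trans (cong (n ∸_) dH≡n) (n∸n≡0 n)))) (_ ∣0)

distance-d-or-n? : ∀ {q n} d (u v : Word q n) → Dec (dH u v ≡ d ⊎ dH u v ≡ n)
distance-d-or-n? {n = n} d u v = (dH u v ℕ.≟ d) ⊎-dec (dH u v ℕ.≟ n)

sum-agreements≡∑-occurrences : ∀ {q n} (u : Word q n) (B : List (Word q n)) →
  sum (map (agreements u) B) ≡ ∑[ i < n ] occurrences B i (lookup u i)
sum-agreements≡∑-occurrences {n = n} u B =
  trans (sum-map-∑-comm n (λ v i → indicator (lookup v i ≟ lookup u i)) B)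
        (∑.sum-cong-≗ (λ i → sym (length-filter≡sum-indicator (λ w → lookup w i ≟ lookup u i) B)))

occurrences-block-other : ∀ {q n} (C : List (Word q n)) j α s →
  ¬ s ≡ α → occurrences (block C j α) j s ≡ 0
occurrences-block-other C j α s s≢α =
  cong length (filter-none (λ w → lookup w j ≟ s)
    (All.map (λ w≡α w≡s → s≢α (trans (sym w≡s) w≡α)) (all-filter (λ w → lookup w j ≟ α) C)))

proposition4 : (q n d m : ℕ) (C : List (Word q n)) → IsCode q n d C →
    (j : Fin n) (α : Fin q) →
    (∀ (i : Fin n) → ¬ (i ≡ j) → ∀ (s : Fin q) → occurrences (block C j α) i s ≡ m) →
    ¬ ((n ∸ d) ∣ (m * (n ∸ 1))) →
    ∀ (u : Word q n) → u ∈ C → ¬ (lookup u j ≡ α) →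
    Σ (Word q n) (λ v → v ∈ block C j α × ¬ (dH u v ≡ d) × ¬ (dH u v ≡ n))
proposition4 q n d m C _ j α balanced n∸d∤ u _ uj≢α with all? (distance-d-or-n? d u) (block C j α)
... | no notAll with find (¬All⇒Any¬ (distance-d-or-n? d u) _ notAll)
...   | v , v∈B , ¬d⊎n = v , v∈B , ¬d⊎n ∘ inj₁ , ¬d⊎n ∘ inj₂
proposition4 q n d m C _ j α balanced n∸d∤ u _ uj≢α | yes all-d⊎n =
  contradiction (subst ((n ∸ d) ∣_) total (∣-sum-map (agreements u) (All.map (n∸d∣agreements u _) all-d⊎n))) n∸d∤
  where
  total : sum (map (agreements u) (block C j α)) ≡ m * (n ∸ 1)
  total = trans (sum-agreements≡∑-occurrences u (block C j α))
                (∑-zero-at-one-point _ j (occurrences-block-other C j α (lookup u j) uj≢α)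
                                         (λ i i≢j → balanced i i≢j (lookup u i)))
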